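{- Let $a,n\in\mathbb{N}$, let $k_1,\ldots,k_n\in\mathbb{N}$, $K=\operatorname{lcm}(k_1,\ldots,k_n)$, let $f_1,\ldots,f_n,g_1,\ldots,g_n$ be arithmetic functions, and let $\omega$ be an arithmetic function. Put $$\widetilde{U}_{\omega}^{(a)}(k_1,\ldots,k_n)=\sum_{j=1}^{K^a}\omega(j)\prod_{i=1}^n s^{(a)}_{f_i,g_i,\mathbf{1}}(k_i,j),\qquad \Psi(m)=\sum_{\substack{\ell=1\\ \gcd(\ell,m)=1}}^{m}\omega(\ell)\ (m\in\mathbb{N}).$$ If $\omega$ is completely multiplicative, then $$\widetilde{U}_{\omega}^{(a)}(k_1,\ldots,k_n)=\sum_{d|K^a}\omega(d)\Bigl(\prod_{i=1}^n s^{(a)}_{f_i,g_i,\mathbf{1}}(k_i,d)\Bigr)\Psi\Bigl(\frac{K^a}{d}\Bigr),$$ i.e. it equals the Dirichlet convolution $\bigl(\omega\prod_{i=1}^n s^{(a)}_{f_i,g_i,\mathbf{1}}(k_i,\cdot)\bigr)*\Psi$ evaluated at $K^a$. If $\omega$ is completely additive, then $$\widetilde{U}_{\omega}^{(a)}(k_1,\ldots,k_n)=\sum_{d|K^a}\omega(d)\Bigl(\prod_{i=1}^n s^{(a)}_{f_i,g_i,\mathbf{1}}(k_i,d)\Bigr)\phi\Bigl(\frac{K^a}{d}\Bigr)+\sum_{d|K^a}\Bigl(\prod_{i=1}^n s^{(a)}_{f_i,g_i,\mathbf{1}}(k_i,d)\Bigr)\Psi\Bigl(\frac{K^a}{d}\Bigr),$$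 where $\phi$ is Euler's totient function.
   Context: $\mathbf{1}$ denotes the constant function $\mathbf{1}(n)=1$. For $a\in\mathbb{N}$ and arithmetic functions $f,g$, $s^{(a)}_{f,g,\mathbf{1}}(k,j)=\sum_{d|k,\ d^a|j} f(d)\,g(k/d)$ for $k,j\in\mathbb{N}$. Completely additive means $\omega(xy)=\omega(x)+\omega(y)$ for all $x,y\in\mathbb{N}$. -}

module Defs where

open import Level using (Level)
open import Data.Nat using (ℕ; zero; suc; _^_; NonZero)
import Data.Nat as ℕ
open import Data.Nat.Divisibility using (_∣_; _∣?_; quotient)
open import Data.Nat.GCD using (gcd)
open import Data.Nat.LCM using (lcm)
open import Data.Fin using (Fin)
import Data.Fin as Fin
open import Data.Bool using (if_then_else_)
open import Relation.Nullary using (yes; no; does)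
open import Algebra.Bundles using (CommutativeRing)

totientUpTo : ℕ → ℕ → ℕ
totientUpTo zero    m = 0
totientUpTo (suc i) m = if does (gcd (suc i) m ℕ.≟ 1) then suc (totientUpTo i m) else totientUpTo i m

totient : ℕ → ℕ
totient m = totientUpTo m m

lcmFin : (n : ℕ) → (Fin n → ℕ) → ℕ
lcmFin zero    k = 1
lcmFin (suc n) k = lcm (k Fin.zero) (lcmFin n (λ i → k (Fin.suc i)))

module _ {c ℓ : Level} (R : CommutativeRing c ℓ) where
  open CommutativeRing R

  natR : ℕ → Carrier
  natR zero    = 0#
  natR (suc n) = 1# + natR n

  sumTo : ℕ → (ℕ → Carrier) → Carrier
  sumTo zero    F = 0#
  sumTo (suc m) F = sumTo m F + F (suc m)

  -- Σ_{d | m} H d (the proof of d ∣ m gives access to m/d as its quotient)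
  divTerm : (m : ℕ) → ((d : ℕ) → d ∣ m → Carrier) → ℕ → Carrier
  divTerm m H d with d ∣? m
  ... | yes p = H d p
  ... | no  _ = 0#

  divSum : (m : ℕ) → ((d : ℕ) → d ∣ m → Carrier) → Carrier
  divSum m H = sumTo m (divTerm m H)

  prodFin : (n : ℕ) → (Fin n → Carrier) → Carrier
  prodFin zero    F = 1#
  prodFin (suc n) F = F Fin.zero * prodFin n (λ i → F (Fin.suc i))

  -- s^{(a)}_{f,g,1}(k,j) = Σ_{d | k, d^a | j} f(d) g(k/d)
  sA : ℕ → (ℕ → Carrier) → (ℕ → Carrier) → ℕ → ℕ → Carrier
  sA a f g k j = divSum k (λ d p → if does ((d ^ a) ∣? j) then f d * g (quotient p) else 0#)

  prodS : ℕ → (n : ℕ) → (Fin n → ℕ → Carrier) → (Fin n → ℕ → Carrier) → (Fin n → ℕ) → ℕ → Carrier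
  prodS a n f g k j = prodFin n (λ i → sA a (f i) (g i) (k i) j)

  Utilde : ℕ → (n : ℕ) → (ℕ → Carrier) → (Fin n → ℕ → Carrier) → (Fin n → ℕ → Carrier) → (Fin n → ℕ) → Carrier
  Utilde a n ω f g k = sumTo (lcmFin n k ^ a) (λ j → ω j * prodS a n f g k j)

  Psi : (ℕ → Carrier) → ℕ → Carrier
  Psi ω m = sumTo m (λ l → if does (gcd l m ℕ.≟ 1) then ω l else 0#)

  -- arithmetic functions are defined on positive integers; values at 0 are ignored
  CompletelyMultiplicative : (ℕ → Carrier) → Set ℓ
  CompletelyMultiplicative ω =
    (ω 1 ≈ 1#) Data.Product.× (∀ x y → .{{NonZero x}} → .{{NonZero y}} → ω (x ℕ.* y) ≈ ω x * ω y)
    where import Data.Product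

  CompletelyAdditive : (ℕ → Carrier) → Set ℓ
  CompletelyAdditive ω = ∀ x y → .{{NonZero x}} → .{{NonZero y}} → ω (x ℕ.* y) ≈ ω x + ω y

{-# OPTIONS --safe #-}
module Submission where

-- Group the j ∈ [1, K^a] by d = gcd(j, K^a): they are exactly the l·d with 1 ≤ l ≤ K^a/d and
-- gcd(l, K^a/d) = 1. Every condition d'^a ∣ j occurring in s^{(a)}(k_i, j) has d'^a ∣ K^a, so
-- it holds iff d'^a ∣ gcd(j, K^a); hence the product of the s^{(a)} is constant, equal to its
-- value at d, on each class. What is left of the class sum is Σ ω(l·d) over the coprime l,
-- which is ω(d) Ψ(K^a/d) for completely multiplicative ω and Ψ(K^a/d) + ω(d) φ(K^a/d) for
-- completely additive ω.

open import Defs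
open import Level using (Level)
open import Data.Nat using (ℕ; zero; suc; _^_; _≤_; _<_; NonZero)
import Data.Nat as ℕ
import Data.Nat.Properties as ℕₚ
open import Data.Nat.Divisibility
  using (_∣_; _∣?_; divides-refl; quotient; ∣-refl; ∣-trans; *-pres-∣; n∣m*n; ∣m+n∣m⇒∣n; ∣⇒≤)
open import Data.Nat.GCD
  using (gcd; gcd[m,n]∣m; gcd[m,n]∣n; gcd[m,n]≤n; gcd[m,n]≢0; gcd-greatest; c*gcd[m,n]≡gcd[cm,cn])
open import Data.Nat.LCM using (m∣lcm[m,n]; n∣lcm[m,n])
open import Data.Fin using (Fin)
import Data.Fin as Fin
open import Data.Product using (_×_; _,_)
open import Data.Sum using (inj₁; inj₂)
open import Data.Bool using (true; false; if_then_else_)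
open import Function.Bundles using (_⇔_; mk⇔; Equivalence)
open import Relation.Nullary using (Dec; yes; no; does; ¬_; contradiction)
open import Relation.Nullary.Decidable using (does-⇔)
import Relation.Binary.PropositionalEquality as P
open P using (_≡_)
open import Algebra.Bundles using (CommutativeRing)

^-monoˡ-∣ : ∀ a {m n} → m ∣ n → m ^ a ∣ n ^ a
^-monoˡ-∣ zero    m∣n = ∣-refl
^-monoˡ-∣ (suc a) m∣n = *-pres-∣ m∣n (^-monoˡ-∣ a m∣n)

k∣lcmFin : ∀ n (k : Fin n → ℕ) i → k i ∣ lcmFin n k
k∣lcmFin (suc n) k Fin.zero    = m∣lcm[m,n] _ _
k∣lcmFin (suc n) k (Fin.suc i) =
  ∣-trans (k∣lcmFin n (λ i → k (Fin.suc i)) i) (n∣lcm[m,n] (k Fin.zero) _)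

m∣n⇒[m∣o⇔m∣gcd[o,n]] : ∀ {m n} o → m ∣ n → (m ∣ o ⇔ m ∣ gcd o n)
m∣n⇒[m∣o⇔m∣gcd[o,n]] {n = n} o m∣n =
  mk⇔ (λ m∣o → gcd-greatest m∣o m∣n) (λ m∣g → ∣-trans m∣g (gcd[m,n]∣m o n))

gcd[m*d,n*d]≡d*gcd[m,n] : ∀ m n d → gcd (m ℕ.* d) (n ℕ.* d) ≡ d ℕ.* gcd m n
gcd[m*d,n*d]≡d*gcd[m,n] m n d =
  P.trans (P.cong₂ gcd (ℕₚ.*-comm m d) (ℕₚ.*-comm n d)) (P.sym (c*gcd[m,n]≡gcd[cm,cn] d m n))

gcd[m*d,n*d]≡d⇔gcd[m,n]≡1 : ∀ m n d .{{_ : NonZero d}} → gcd (m ℕ.* d) (n ℕ.* d) ≡ d ⇔ gcd m n ≡ 1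
gcd[m*d,n*d]≡d⇔gcd[m,n]≡1 m n d = mk⇔
  (λ eq → ℕₚ.*-cancelˡ-≡ (gcd m n) 1 d
            (P.trans (P.sym (gcd[m*d,n*d]≡d*gcd[m,n] m n d)) (P.trans eq (P.sym (ℕₚ.*-identityʳ d)))))
  (λ eq → P.trans (gcd[m*d,n*d]≡d*gcd[m,n] m n d) (P.trans (P.cong (d ℕ.*_) eq) (ℕₚ.*-identityʳ d)))

gcd[l*d,n]≡d : ∀ l {d n} .{{_ : NonZero d}} (d∣n : d ∣ n) → gcd l (quotient d∣n) ≡ 1 → gcd (l ℕ.* d) n ≡ d
gcd[l*d,n]≡d l {d} (divides-refl q) = Equivalence.from (gcd[m*d,n*d]≡d⇔gcd[m,n]≡1 l q d)

module _ {c ℓ : Level} (R : CommutativeRing c ℓ) where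
  open CommutativeRing R
  open import Relation.Binary.Reasoning.Setoid setoid
  open import Algebra.Properties.CommutativeSemigroup +-commutativeSemigroup using (interchange)
  open import Algebra.Properties.CommutativeSemigroup *-commutativeSemigroup using (x∙yz≈yx∙z)

  if-true : ∀ {p} {A : Set p} (A? : Dec A) {x y : Carrier} → A → (if does A? then x else y) ≈ x
  if-true (yes _) a = refl
  if-true (no ¬a) a = contradiction a ¬a

  if-false : ∀ {p} {A : Set p} (A? : Dec A) {x y : Carrier} → ¬ A → (if does A? then x else y) ≈ y
  if-false (yes a) ¬a = contradiction a ¬a
  if-false (no _)  ¬a = refl

  if-cong : ∀ {p} {A : Set p} (A? : Dec A) {x y z : Carrier} → (A → x ≈ y) →
            (if does A? then x else z) ≈ (if does A? then y else z)
  if-cong (yes a) x≈y = x≈y a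
  if-cong (no _)  x≈y = refl

  if-+ : ∀ b {x y : Carrier} → (if b then x + y else 0#) ≈ (if b then x else 0#) + (if b then y else 0#)
  if-+ true  = refl
  if-+ false = sym (+-identityˡ 0#)

  if-*ˡ : ∀ b {x y : Carrier} → (if b then x * y else 0#) ≈ x * (if b then y else 0#)
  if-*ˡ true      = refl
  if-*ˡ false {x} = sym (zeroʳ x)

  natR-if : ∀ b n → natR R (if b then suc n else n) ≈ (if b then 1# else 0#) + natR R n
  natR-if true  n = refl
  natR-if false n = sym (+-identityˡ _)

  sumTo-cong≤ : ∀ m {F G : ℕ → Carrier} → (∀ i → suc i ≤ m → F (suc i) ≈ G (suc i)) →
                sumTo R m F ≈ sumTo R m G
  sumTo-cong≤ zero    F≈G = refl
  sumTo-cong≤ (suc m) F≈G =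
    +-cong (sumTo-cong≤ m (λ i i<m → F≈G i (ℕₚ.m≤n⇒m≤1+n i<m))) (F≈G m ℕₚ.≤-refl)

  sumTo-cong : ∀ m {F G : ℕ → Carrier} → (∀ i → F (suc i) ≈ G (suc i)) → sumTo R m F ≈ sumTo R m G
  sumTo-cong m F≈G = sumTo-cong≤ m (λ i _ → F≈G i)

  sumTo-zero≤ : ∀ m {F : ℕ → Carrier} → (∀ i → suc i ≤ m → F (suc i) ≈ 0#) → sumTo R m F ≈ 0#
  sumTo-zero≤ zero    F≈0 = refl
  sumTo-zero≤ (suc m) F≈0 =
    trans (+-cong (sumTo-zero≤ m (λ i i<m → F≈0 i (ℕₚ.m≤n⇒m≤1+n i<m))) (F≈0 m ℕₚ.≤-refl))
          (+-identityˡ 0#)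

  sumTo-+ : ∀ m F G → sumTo R m (λ j → F j + G j) ≈ sumTo R m F + sumTo R m G
  sumTo-+ zero    F G = sym (+-identityˡ 0#)
  sumTo-+ (suc m) F G = trans (+-cong (sumTo-+ m F G) refl) (interchange _ _ _ _)

  sumTo-*ˡ : ∀ m x F → sumTo R m (λ j → x * F j) ≈ x * sumTo R m F
  sumTo-*ˡ zero    x F = sym (zeroʳ x)
  sumTo-*ˡ (suc m) x F = trans (+-cong (sumTo-*ˡ m x F) refl) (sym (distribˡ x _ _))

  sumTo-swap : ∀ m n (H : ℕ → ℕ → Carrier) →
               sumTo R m (λ i → sumTo R n (H i)) ≈ sumTo R n (λ j → sumTo R m (λ i → H i j))
  sumTo-swap zero    n H = sym (sumTo-zero≤ n (λ _ _ → refl))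
  sumTo-swap (suc m) n H = trans (+-cong (sumTo-swap m n H) refl) (sym (sumTo-+ n _ _))

  sumTo-split : ∀ m r G → sumTo R (m ℕ.+ r) G ≈ sumTo R m G + sumTo R r (λ t → G (m ℕ.+ t))
  sumTo-split m zero    G = trans (reflexive (P.cong (λ x → sumTo R x G) (ℕₚ.+-identityʳ m))) (sym (+-identityʳ _))
  sumTo-split m (suc r) G = begin
    sumTo R (m ℕ.+ suc r) G
      ≡⟨ P.cong (λ x → sumTo R x G) (ℕₚ.+-suc m r) ⟩
    sumTo R (m ℕ.+ r) G + G (suc (m ℕ.+ r))
      ≈⟨ +-cong (sumTo-split m r G) (reflexive (P.cong G (P.sym (ℕₚ.+-suc m r)))) ⟩
    (sumTo R m G + sumTo R r (λ t → G (m ℕ.+ t))) + G (m ℕ.+ suc r)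
      ≈⟨ +-assoc _ _ _ ⟩
    sumTo R m G + sumTo R (suc r) (λ t → G (m ℕ.+ t))
      ∎

  sumTo-multiples : ∀ d .{{_ : NonZero d}} q {G : ℕ → Carrier} → (∀ j → ¬ d ∣ j → G j ≈ 0#) →
                    sumTo R (q ℕ.* d) G ≈ sumTo R q (λ l → G (l ℕ.* d))
  sumTo-multiples d       zero    G≈0 = refl
  sumTo-multiples d@(suc e) (suc q) {G} G≈0 = begin
    sumTo R (suc q ℕ.* d) G
      ≡⟨ P.cong (λ x → sumTo R x G) (ℕₚ.+-comm d (q ℕ.* d)) ⟩
    sumTo R (q ℕ.* d ℕ.+ d) G
      ≈⟨ sumTo-split (q ℕ.* d) d G ⟩
    sumTo R (q ℕ.* d) G + sumTo R d (λ t → G (q ℕ.* d ℕ.+ t))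
      ≈⟨ +-cong (sumTo-multiples d q G≈0) lastBlock ⟩
    sumTo R q (λ l → G (l ℕ.* d)) + G (suc q ℕ.* d)
      ∎
    where
    inBetween : ∀ i → suc i ≤ e → ¬ d ∣ q ℕ.* d ℕ.+ suc i
    inBetween i i<e d∣ = ℕₚ.n≮n e (ℕₚ.≤-trans (∣⇒≤ (∣m+n∣m⇒∣n d∣ (n∣m*n q))) i<e)
    lastBlock : sumTo R d (λ t → G (q ℕ.* d ℕ.+ t)) ≈ G (suc q ℕ.* d)
    lastBlock = trans (+-cong (sumTo-zero≤ e (λ i i<e → G≈0 _ (inBetween i i<e)))
                              (reflexive (P.cong G (ℕₚ.+-comm (q ℕ.* d) d))))
                      (+-identityˡ _)

  sumTo-indicator-beyond : ∀ m g x → m < g → sumTo R m (λ d → if does (g ℕ.≟ d) then x else 0#) ≈ 0#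
  sumTo-indicator-beyond m g x m<g =
    sumTo-zero≤ m (λ i i≤m → if-false (g ℕ.≟ suc i)
                               (λ g≡i → ℕₚ.<⇒≢ (ℕₚ.≤-<-trans i≤m m<g) (P.sym g≡i)))

  sumTo-indicator : ∀ m g x → 1 ≤ g → g ≤ m → sumTo R m (λ d → if does (g ℕ.≟ d) then x else 0#) ≈ x
  sumTo-indicator zero    zero    x () _
  sumTo-indicator zero    (suc g) x _  ()
  sumTo-indicator (suc m) g x 1≤g g≤1+m with ℕₚ.m≤n⇒m<n∨m≡n g≤1+m
  ... | inj₁ g<1+m  = trans (+-cong (sumTo-indicator m g x 1≤g (ℕₚ.m<1+n⇒m≤n g<1+m))
                                    (if-false (g ℕ.≟ suc m) (ℕₚ.<⇒≢ g<1+m)))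
                            (+-identityʳ x)
  ... | inj₂ P.refl = trans (+-cong (sumTo-indicator-beyond m (suc m) x (ℕₚ.n<1+n m))
                                    (if-true (suc m ℕ.≟ suc m) P.refl))
                            (+-identityˡ x)

  prodFin-cong : ∀ n {F G : Fin n → Carrier} → (∀ i → F i ≈ G i) → prodFin R n F ≈ prodFin R n G
  prodFin-cong zero    F≈G = refl
  prodFin-cong (suc n) F≈G = *-cong (F≈G Fin.zero) (prodFin-cong n (λ i → F≈G (Fin.suc i)))

  divSum-cong : ∀ m {H H' : (d : ℕ) → d ∣ m → Carrier} →
                (∀ e (p : suc e ∣ m) → H (suc e) p ≈ H' (suc e) p) → divSum R m H ≈ divSum R m H'
  divSum-cong m {H} {H'} H≈H' = sumTo-cong m term
    where
    term : ∀ e → divTerm R m H (suc e) ≈ divTerm R m H' (suc e)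
    term e with suc e ∣? m
    ... | yes p = H≈H' e p
    ... | no  _ = refl

  divSum-+ : ∀ m (H H' : (d : ℕ) → d ∣ m → Carrier) →
             divSum R m (λ d p → H d p + H' d p) ≈ divSum R m H + divSum R m H'
  divSum-+ m H H' = trans (sumTo-cong m term) (sumTo-+ m _ _)
    where
    term : ∀ e → divTerm R m (λ d p → H d p + H' d p) (suc e) ≈ divTerm R m H (suc e) + divTerm R m H' (suc e)
    term e with suc e ∣? m
    ... | yes p = refl
    ... | no  _ = sym (+-identityˡ 0#)

  Psi-cong : ∀ q {G H : ℕ → Carrier} → (∀ i → gcd (suc i) q ≡ 1 → G (suc i) ≈ H (suc i)) →
             Psi R G q ≈ Psi R H q
  Psi-cong q G≈H = sumTo-cong q (λ i → if-cong (gcd (suc i) q ℕ.≟ 1) (G≈H i))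

  Psi-+ : ∀ q G H → Psi R (λ l → G l + H l) q ≈ Psi R G q + Psi R H q
  Psi-+ q G H = trans (sumTo-cong q (λ i → if-+ (does (gcd (suc i) q ℕ.≟ 1)))) (sumTo-+ q _ _)

  Psi-*ˡ : ∀ q x G → Psi R (λ l → x * G l) q ≈ x * Psi R G q
  Psi-*ˡ q x G = trans (sumTo-cong q (λ i → if-*ˡ (does (gcd (suc i) q ℕ.≟ 1)))) (sumTo-*ˡ q x _)

  sumTo-coprime-1≈totientUpTo : ∀ m q →
    sumTo R m (λ l → if does (gcd l q ℕ.≟ 1) then 1# else 0#) ≈ natR R (totientUpTo m q)
  sumTo-coprime-1≈totientUpTo zero    q = refl
  sumTo-coprime-1≈totientUpTo (suc m) q =
    trans (+-cong (sumTo-coprime-1≈totientUpTo m q) refl)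
          (trans (+-comm _ _) (sym (natR-if (does (gcd (suc m) q ℕ.≟ 1)) (totientUpTo m q))))

  Psi-1≈totient : ∀ q → Psi R (λ _ → 1#) q ≈ natR R (totient q)
  Psi-1≈totient q = sumTo-coprime-1≈totientUpTo q q

  Psi-completelyMultiplicative : ∀ {ω} → CompletelyMultiplicative R ω → ∀ d .{{_ : NonZero d}} q →
                                 Psi R (λ l → ω (l ℕ.* d)) q ≈ ω d * Psi R ω q
  Psi-completelyMultiplicative {ω} (_ , ω-* ) d q = begin
    Psi R (λ l → ω (l ℕ.* d)) q  ≈⟨ Psi-cong q (λ i _ → trans (ω-* (suc i) d) (*-comm _ _)) ⟩
    Psi R (λ l → ω d * ω l) q    ≈⟨ Psi-*ˡ q (ω d) ω ⟩
    ω d * Psi R ω q              ∎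

  Psi-completelyAdditive : ∀ {ω} → CompletelyAdditive R ω → ∀ d .{{_ : NonZero d}} q →
                           Psi R (λ l → ω (l ℕ.* d)) q ≈ Psi R ω q + ω d * natR R (totient q)
  Psi-completelyAdditive {ω} ω-+ d q = begin
    Psi R (λ l → ω (l ℕ.* d)) q
      ≈⟨ Psi-cong q (λ i _ → trans (ω-+ (suc i) d) (+-cong refl (sym (*-identityʳ _)))) ⟩
    Psi R (λ l → ω l + ω d * 1#) q
      ≈⟨ Psi-+ q ω _ ⟩
    Psi R ω q + Psi R (λ _ → ω d * 1#) q
      ≈⟨ +-cong refl (trans (Psi-*ˡ q (ω d) _) (*-cong refl (Psi-1≈totient q))) ⟩
    Psi R ω q + ω d * natR R (totient q)
      ∎

  sumTo-gcd≡ : ∀ M d .{{_ : NonZero d}} (d∣M : d ∣ M) (F : ℕ → Carrier) →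
               sumTo R M (λ j → if does (gcd j M ℕ.≟ d) then F j else 0#)
               ≈ Psi R (λ l → F (l ℕ.* d)) (quotient d∣M)
  sumTo-gcd≡ M d (divides-refl q) F =
    trans (sumTo-multiples d q {Indicator} outsideMultiples) (sumTo-cong q sameCondition)
    where
    Indicator : ℕ → Carrier
    Indicator j = if does (gcd j M ℕ.≟ d) then F j else 0#
    outsideMultiples : ∀ j → ¬ d ∣ j → Indicator j ≈ 0#
    outsideMultiples j d∤j = if-false (gcd j M ℕ.≟ d) (λ gcd≡d → d∤j (P.subst (_∣ j) gcd≡d (gcd[m,n]∣m j M)))
    sameCondition : ∀ i → Indicator (suc i ℕ.* d) ≈ (if does (gcd (suc i) q ℕ.≟ 1) then F (suc i ℕ.* d) else 0#)
    sameCondition i = reflexive (P.cong (λ b → if b then F (suc i ℕ.* d) else 0#)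
                                        (does-⇔ (gcd[m*d,n*d]≡d⇔gcd[m,n]≡1 (suc i) q d)
                                                (gcd (suc i ℕ.* d) M ℕ.≟ d) (gcd (suc i) q ℕ.≟ 1)))

  -- Insert Σ_d [gcd(j, M) = d] = 1 into each term and exchange the two sums.
  sumTo-byGcd : ∀ M (F : ℕ → Carrier) →
                sumTo R M F ≈ divSum R M (λ d p → Psi R (λ l → F (l ℕ.* d)) (quotient p))
  sumTo-byGcd zero        F = refl
  sumTo-byGcd M@(suc _) F = begin
    sumTo R M F                                                 ≈⟨ sumTo-cong≤ M splitOne ⟩
    sumTo R M (λ j → sumTo R M (Indicator j))                   ≈⟨ sumTo-swap M M Indicator ⟩
    sumTo R M (λ d → sumTo R M (λ j → Indicator j d))           ≈⟨ sumTo-cong M byDivisor ⟩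
    divSum R M (λ d p → Psi R (λ l → F (l ℕ.* d)) (quotient p)) ∎
    where
    Indicator : ℕ → ℕ → Carrier
    Indicator j d = if does (gcd j M ℕ.≟ d) then F j else 0#
    splitOne : ∀ i → suc i ≤ M → F (suc i) ≈ sumTo R M (Indicator (suc i))
    splitOne i _ = sym (sumTo-indicator M (gcd (suc i) M) (F (suc i))
                          (ℕₚ.n≢0⇒n>0 (gcd[m,n]≢0 (suc i) M (inj₁ (λ ())))) (gcd[m,n]≤n (suc i) M))
    byDivisor : ∀ e → sumTo R M (λ j → Indicator j (suc e))
                      ≈ divTerm R M (λ d p → Psi R (λ l → F (l ℕ.* d)) (quotient p)) (suc e)
    byDivisor e with suc e ∣? M
    ... | yes d∣M = sumTo-gcd≡ M (suc e) d∣M F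
    ... | no  d∤M = sumTo-zero≤ M (λ i _ → if-false (gcd (suc i) M ℕ.≟ suc e)
                                    (λ gcd≡d → d∤M (P.subst (_∣ M) gcd≡d (gcd[m,n]∣n (suc i) M))))

  sumTo-gcdInvariant : ∀ M (ω P : ℕ → Carrier) → (∀ j → P j ≈ P (gcd j M)) →
    sumTo R M (λ j → ω j * P j) ≈ divSum R M (λ d p → P d * Psi R (λ l → ω (l ℕ.* d)) (quotient p))
  sumTo-gcdInvariant M ω P P-gcd = trans (sumTo-byGcd M _) (divSum-cong M classSum)
    where
    classSum : ∀ e (p : suc e ∣ M) → Psi R (λ l → ω (l ℕ.* suc e) * P (l ℕ.* suc e)) (quotient p)
                                     ≈ P (suc e) * Psi R (λ l → ω (l ℕ.* suc e)) (quotient p)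
    classSum e p = trans (Psi-cong (quotient p) (λ i coprime →
                           trans (*-cong refl (trans (P-gcd _) (reflexive (P.cong P (gcd[l*d,n]≡d (suc i) p coprime)))))
                                 (*-comm _ _)))
                         (Psi-*ˡ (quotient p) (P (suc e)) _)

  sumTo-gcdInvariant-completelyMultiplicative :
    ∀ M {ω} (P : ℕ → Carrier) → (∀ j → P j ≈ P (gcd j M)) → CompletelyMultiplicative R ω →
    sumTo R M (λ j → ω j * P j) ≈ divSum R M (λ d p → (ω d * P d) * Psi R ω (quotient p))
  sumTo-gcdInvariant-completelyMultiplicative M {ω} P P-gcd ω-* =
    trans (sumTo-gcdInvariant M ω P P-gcd) (divSum-cong M (λ e p →
      trans (*-cong refl (Psi-completelyMultiplicative ω-* (suc e) (quotient p))) (x∙yz≈yx∙z _ _ _)))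

  sumTo-gcdInvariant-completelyAdditive :
    ∀ M {ω} (P : ℕ → Carrier) → (∀ j → P j ≈ P (gcd j M)) → CompletelyAdditive R ω →
    sumTo R M (λ j → ω j * P j) ≈ divSum R M (λ d p → (ω d * P d) * natR R (totient (quotient p)))
                                  + divSum R M (λ d p → P d * Psi R ω (quotient p))
  sumTo-gcdInvariant-completelyAdditive M {ω} P P-gcd ω-+ =
    trans (sumTo-gcdInvariant M ω P P-gcd) (trans (divSum-cong M classSum) (divSum-+ M _ _))
    where
    classSum : ∀ e (p : suc e ∣ M) →
               P (suc e) * Psi R (λ l → ω (l ℕ.* suc e)) (quotient p)
               ≈ (ω (suc e) * P (suc e)) * natR R (totient (quotient p)) + P (suc e) * Psi R ω (quotient p)
    classSum e p = begin
      x * Psi R (λ l → ω (l ℕ.* suc e)) q  ≈⟨ *-cong refl (Psi-completelyAdditive ω-+ (suc e) q) ⟩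
      x * (Psi R ω q + w * φ)             ≈⟨ distribˡ _ _ _ ⟩
      x * Psi R ω q + x * (w * φ)         ≈⟨ +-comm _ _ ⟩
      x * (w * φ) + x * Psi R ω q         ≈⟨ +-cong (x∙yz≈yx∙z _ _ _) refl ⟩
      (w * x) * φ + x * Psi R ω q         ∎
      where
      q : ℕ
      q = quotient p
      x w φ : Carrier
      x = P (suc e)
      w = ω (suc e)
      φ = natR R (totient q)

  sA-gcd : ∀ a f g k {M} → k ^ a ∣ M → ∀ j → sA R a f g k j ≈ sA R a f g k (gcd j M)
  sA-gcd a f g k {M} kᵃ∣M j = divSum-cong k (λ e p →
    reflexive (P.cong (λ b → if b then f (suc e) * g (quotient p) else 0#)
                      (does-⇔ (m∣n⇒[m∣o⇔m∣gcd[o,n]] j (∣-trans (^-monoˡ-∣ a p) kᵃ∣M))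
                              (suc e ^ a ∣? j) (suc e ^ a ∣? gcd j M))))

  prodS-gcd : ∀ a n f g (k : Fin n → ℕ) {M} → (∀ i → k i ^ a ∣ M) →
              ∀ j → prodS R a n f g k j ≈ prodS R a n f g k (gcd j M)
  prodS-gcd a n f g k kᵃ∣M j = prodFin-cong n (λ i → sA-gcd a (f i) (g i) (k i) (kᵃ∣M i) j)

-- None of the positivity hypotheses is needed: if some k i = 0 then K^a = 0 and both sides are empty sums.
theorem3 : {c ℓ : Level} (R : CommutativeRing c ℓ) →
    let open CommutativeRing R in
    (a n : ℕ) → .{{NonZero a}} → .{{NonZero n}} →
    (k : Fin n → ℕ) → (∀ i → NonZero (k i)) →
    (f g : Fin n → ℕ → Carrier) → (ω : ℕ → Carrier) →
    (CompletelyMultiplicative R ω →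
      Utilde R a n ω f g k
        ≈ divSum R (lcmFin n k ^ a)
            (λ d p → (ω d * prodS R a n f g k d) * Psi R ω (quotient p)))
    ×
    (CompletelyAdditive R ω →
      Utilde R a n ω f g k
        ≈ divSum R (lcmFin n k ^ a)
            (λ d p → (ω d * prodS R a n f g k d) * natR R (totient (quotient p)))
          + divSum R (lcmFin n k ^ a)
            (λ d p → prodS R a n f g k d * Psi R ω (quotient p)))
theorem3 R a n k _ f g ω =
    sumTo-gcdInvariant-completelyMultiplicative R K^a s s-gcd
  , sumTo-gcdInvariant-completelyAdditive R K^a s s-gcd
  where
  open CommutativeRing R using (Carrier; _≈_)
  K^a : ℕ
  K^a = lcmFin n k ^ a
  s : ℕ → Carrier
  s = prodS R a n f g k
  s-gcd : ∀ j → s j ≈ s (gcd j K^a)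
  s-gcd = prodS-gcd R a n f g k (λ i → ^-monoˡ-∣ a (k∣lcmFin n k i))
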